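{- Let $\mathcal{F}=\langle X,Y,\le_X,\le_Y,R,T\rangle$ and $\hat{\mathcal{F}}=\langle \hat X,\hat Y,\le_{\hat X},\le_{\hat Y},\hat R,\hat T\rangle$ be FI-frames and $(g,h)\colon\mathcal{F}\to\hat{\mathcal{F}}$ a FI-morphism. Then $(g^*,h^*)\colon\mathcal{M}_{\hat{\mathcal{F}}}\to\mathcal{M}_{\mathcal{F}}$, where $g^*(U)=g^{ -1}(U)$ for $U\in\mathcal{P}_i(\hat X)$ and $h^*(V)=h^{ -1}(V)$ for $V\in\mathcal{P}_i(\hat Y)$, is a FIDL-homomorphism.
   Context: A FI-frame is a structure $\langle X,Y,\le_X,\le_Y,R,T\rangle$ where $\langle X,\le_X\rangle,\langle Y,\le_Y\rangle$ are posets, $R\subseteq X\times Y\times X$, $T\subseteq Y\times X\times X$ satisfy: if $(x,y,z)\in R$, $\bar x\le_X x$, $\bar y\le_Y y$, $z\le_X\bar z$ then $(\bar x,\bar y,\bar z)\in R$; if $(y,x,z)\in T$, $\bar y\le_Y y$, $\bar x\le_X x$, $z\le_X\bar z$ then $(\bar y,\bar x,\bar z)\in T$. A FI-morphism $(g,h)$ is a pair of monotone maps $g\colon X\to\hat X$, $h\colon Y\to\hat Y$ such that: (M1) $(x,y,z)\in R$ implies $(g(x),h(y),g(z))\in\hat R$; (M2) if $(\bar x,\bar y,g(z))\in\hat R$ then there exist $x\in X$, $y\in Y$ with $(x,y,z)\in R$, $\bar x\le g(x)$, $\bar y\le h(y)$; (N1) $(x,y,z)\in T$ implies $(h(x),g(y),g(z))\in\hat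 T$; (N2) if $(\bar x,g(y),\bar z)\in\hat T$ then there exist $x\in Y$, $z\in X$ with $(x,y,z)\in T$, $\bar x\le h(x)$, $g(z)\le\bar z$. For a FI-frame $\mathcal{F}$, $\mathcal{M}_{\mathcal{F}}=\langle\mathcal{P}_i(X),\mathcal{P}_i(Y),f_{\mathcal{F}},i_{\mathcal{F}}\rangle$, where $\mathcal{P}_i(\cdot)$ is the bounded distributive lattice of increasing subsets and, for $U\in\mathcal{P}_i(X)$, $V\in\mathcal{P}_i(Y)$: $f_{\mathcal{F}}(U,V)=\{z\in X:\exists(x,y)\in U\times V,\ (x,y,z)\in R\}$, $i_{\mathcal{F}}(V,U)=\{y\in X:\forall x\in Y\,\forall z\in X\,(((x,y,z)\in T\text{ and }x\in V)\Rightarrow z\in U)\}$. A FIDL-homomorphism between FIDL-modules $\langle\mathbf{A},\mathbf{B},f,i\rangle\to\langle\hat{\mathbf{A}},\hat{\mathbf{B}},\hat f,\hat i\rangle$ is a pair of bounded lattice homomorphisms $\alpha\colon A\to\hat A$, $\gamma\colon B\to\hat B$ with $\alpha(f(x,b))=\hat f(\alpha(x),\gamma(b))$ and $\alpha(i(b,x))=\hat i(\gamma(b),\alpha(x))$ for all $x\in A$, $b\in B$. -}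

module Defs where

open import Level using (Level; suc; _⊔_)
open import Data.Product using (Σ; ∃; _×_; _,_)
open import Relation.Binary.Core using (Rel)
open import Relation.Binary.Structures using (IsPartialOrder)
open import Relation.Binary.PropositionalEquality using (_≡_)
open import Relation.Unary using (Pred; _∈_; _⊆_; _≐_; _∩_; _∪_)
open import Data.Empty.Polymorphic using (⊥)
open import Data.Unit.Polymorphic using (⊤)

∅ₒ : ∀ {o} {A : Set o} → Pred A o
∅ₒ _ = ⊥

Uₒ : ∀ {o} {A : Set o} → Pred A o
Uₒ _ = ⊤

IsIncreasing : ∀ {o} {A : Set o} → Rel A o → Pred A o → Set o
IsIncreasing _≤_ P = ∀ {a b} → a ≤ b → P a → P b

record FIFrame (o : Level) : Set (suc o) where
  field
    X    : Set o
    Y    : Set o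
    _≤X_ : Rel X o
    _≤Y_ : Rel Y o
    ≤X-po : IsPartialOrder _≡_ _≤X_
    ≤Y-po : IsPartialOrder _≡_ _≤Y_
    R    : X → Y → X → Set o
    T    : Y → X → X → Set o
    R-closed : ∀ {x y z x̄ ȳ z̄} → R x y z → x̄ ≤X x → ȳ ≤Y y → z ≤X z̄ → R x̄ ȳ z̄
    T-closed : ∀ {y x z ȳ x̄ z̄} → T y x z → ȳ ≤Y y → x̄ ≤X x → z ≤X z̄ → T ȳ x̄ z̄

  -- operations of the FIDL-module M_F, on increasing subsets of X, Y
  fF : Pred X o → Pred Y o → Pred X o
  fF Uₓ V z = Σ X λ x → Σ Y λ y → (x ∈ Uₓ) × (y ∈ V) × R x y z

  iF : Pred Y o → Pred X o → Pred X o
  iF V Uₓ y = ∀ (x : Y) (z : X) → T x y z → x ∈ V → z ∈ Uₓ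

open FIFrame

record IsFIMorphism {o : Level} (F F̂ : FIFrame o)
                    (g : X F → X F̂) (h : Y F → Y F̂) : Set o where
  field
    g-mono : ∀ {a b} → _≤X_ F a b → _≤X_ F̂ (g a) (g b)
    h-mono : ∀ {a b} → _≤Y_ F a b → _≤Y_ F̂ (h a) (h b)
    M1 : ∀ {x y z} → R F x y z → R F̂ (g x) (h y) (g z)
    M2 : ∀ {x̄ ȳ z} → R F̂ x̄ ȳ (g z) →
         Σ (X F) λ x → Σ (Y F) λ y →
           R F x y z × _≤X_ F̂ x̄ (g x) × _≤Y_ F̂ ȳ (h y)
    N1 : ∀ {x y z} → T F x y z → T F̂ (h x) (g y) (g z)
    N2 : ∀ {x̄ y z̄} → T F̂ x̄ (g y) z̄ →
         Σ (Y F) λ x → Σ (X F) λ z →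
           T F x y z × _≤Y_ F̂ x̄ (h x) × _≤X_ F̂ (g z) z̄

-- (α, γ) is a FIDL-homomorphism M_F → M_G, where the lattices are
-- P_i(X), P_i(Y) (increasing subsets, equality = extensional ≐).
record IsFIDLHom {o : Level} (F G : FIFrame o)
                 (α : Pred (X F) o → Pred (X G) o)
                 (γ : Pred (Y F) o → Pred (Y G) o) : Set (suc o) where
  field
    α-inc : ∀ A → IsIncreasing (_≤X_ F) A → IsIncreasing (_≤X_ G) (α A)
    γ-inc : ∀ B → IsIncreasing (_≤Y_ F) B → IsIncreasing (_≤Y_ G) (γ B)
    α-resp : ∀ A A′ → A ≐ A′ → α A ≐ α A′
    γ-resp : ∀ B B′ → B ≐ B′ → γ B ≐ γ B′
    α-∩ : ∀ A A′ → IsIncreasing (_≤X_ F) A → IsIncreasing (_≤X_ F) A′ →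
          α (A ∩ A′) ≐ (α A ∩ α A′)
    α-∪ : ∀ A A′ → IsIncreasing (_≤X_ F) A → IsIncreasing (_≤X_ F) A′ →
          α (A ∪ A′) ≐ (α A ∪ α A′)
    α-∅ : α ∅ₒ ≐ ∅ₒ
    α-U : α Uₒ ≐ Uₒ
    γ-∩ : ∀ B B′ → IsIncreasing (_≤Y_ F) B → IsIncreasing (_≤Y_ F) B′ →
          γ (B ∩ B′) ≐ (γ B ∩ γ B′)
    γ-∪ : ∀ B B′ → IsIncreasing (_≤Y_ F) B → IsIncreasing (_≤Y_ F) B′ →
          γ (B ∪ B′) ≐ (γ B ∪ γ B′)
    γ-∅ : γ ∅ₒ ≐ ∅ₒ
    γ-U : γ Uₒ ≐ Uₒ
    pres-f : ∀ A B → IsIncreasing (_≤X_ F) A → IsIncreasing (_≤Y_ F) B →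
             α (fF F A B) ≐ fF G (α A) (γ B)
    pres-i : ∀ A B → IsIncreasing (_≤X_ F) A → IsIncreasing (_≤Y_ F) B →
             α (iF F B A) ≐ iF G (γ B) (α A)

_* : ∀ {o} {A B : Set o} → (A → B) → Pred B o → Pred A o
(g *) P = λ a → P (g a)

-- Preimages along a morphism are computed pointwise, so they preserve
-- intersections, unions, ∅ and the full set definitionally; the content
-- lies in the compatibility with f and i, where the back conditions
-- M2 and N2 supply the witnesses needed in the harder inclusion, and
-- increasingness of the arguments absorbs the inequalities they come with.

module Submission where

open import Defs
open import Level using (Level)
open import Data.Product using (_,_)
open import Relation.Binary.Core using (Rel)
open import Relation.Unary using (Pred; _⊆_; _≐_)
open import Relation.Unary.Properties using (≐-refl)

module _ {o : Level} {A B : Set o} (f : A → B) where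

  *-isIncreasing : {_≤A_ : Rel A o} {_≤B_ : Rel B o} →
                   (∀ {a a′} → a ≤A a′ → f a ≤B f a′) →
                   ∀ P → IsIncreasing _≤B_ P → IsIncreasing _≤A_ ((f *) P)
  *-isIncreasing f-mono P P-inc a≤a′ = P-inc (f-mono a≤a′)

  *-resp-≐ : ∀ P Q → P ≐ Q → (f *) P ≐ (f *) Q
  *-resp-≐ P Q (P⊆Q , Q⊆P) = P⊆Q , Q⊆P

module _ {o : Level} {F F̂ : FIFrame o}
         {g : FIFrame.X F → FIFrame.X F̂} {h : FIFrame.Y F → FIFrame.Y F̂}
         (morphism : IsFIMorphism F F̂ g h) where

  open IsFIMorphism morphism
  open FIFrame F̂ using (_≤X_; _≤Y_)

  module _ (U : Pred (FIFrame.X F̂) o) (V : Pred (FIFrame.Y F̂) o)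
           (U-inc : IsIncreasing _≤X_ U) (V-inc : IsIncreasing _≤Y_ V) where

    *-fF : (g *) (FIFrame.fF F̂ U V) ≐ FIFrame.fF F ((g *) U) ((h *) V)
    *-fF = fF̂⊆fF , fF⊆fF̂
      where
      fF̂⊆fF : (g *) (FIFrame.fF F̂ U V) ⊆ FIFrame.fF F ((g *) U) ((h *) V)
      fF̂⊆fF (x̄ , ȳ , x̄∈U , ȳ∈V , r̂) with M2 r̂
      ... | x , y , r , x̄≤gx , ȳ≤hy = x , y , U-inc x̄≤gx x̄∈U , V-inc ȳ≤hy ȳ∈V , r

      fF⊆fF̂ : FIFrame.fF F ((g *) U) ((h *) V) ⊆ (g *) (FIFrame.fF F̂ U V)
      fF⊆fF̂ (x , y , gx∈U , hy∈V , r) = g x , h y , gx∈U , hy∈V , M1 r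

    *-iF : (g *) (FIFrame.iF F̂ V U) ≐ FIFrame.iF F ((h *) V) ((g *) U)
    *-iF = iF̂⊆iF , iF⊆iF̂
      where
      iF̂⊆iF : (g *) (FIFrame.iF F̂ V U) ⊆ FIFrame.iF F ((h *) V) ((g *) U)
      iF̂⊆iF gy∈iF̂ x z t hx∈V = gy∈iF̂ (h x) (g z) (N1 t) hx∈V

      iF⊆iF̂ : FIFrame.iF F ((h *) V) ((g *) U) ⊆ (g *) (FIFrame.iF F̂ V U)
      iF⊆iF̂ y∈iF x̄ z̄ t̂ x̄∈V with N2 t̂
      ... | x , z , t , x̄≤hx , gz≤z̄ = U-inc gz≤z̄ (y∈iF x z t (V-inc x̄≤hx x̄∈V))

lemma4p11 : ∀ {o : Level} (F F̂ : FIFrame o)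
              (g : FIFrame.X F → FIFrame.X F̂) (h : FIFrame.Y F → FIFrame.Y F̂) →
              IsFIMorphism F F̂ g h →
              IsFIDLHom F̂ F (g *) (h *)
lemma4p11 F F̂ g h morphism = record
  { α-inc  = *-isIncreasing g g-mono
  ; γ-inc  = *-isIncreasing h h-mono
  ; α-resp = *-resp-≐ g
  ; γ-resp = *-resp-≐ h
  ; α-∩    = λ _ _ _ _ → ≐-refl
  ; α-∪    = λ _ _ _ _ → ≐-refl
  ; α-∅    = ≐-refl
  ; α-U    = ≐-refl
  ; γ-∩    = λ _ _ _ _ → ≐-refl
  ; γ-∪    = λ _ _ _ _ → ≐-refl
  ; γ-∅    = ≐-refl
  ; γ-U    = ≐-refl
  ; pres-f = *-fF morphism
  ; pres-i = *-iF morphism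
  }
  where open IsFIMorphism morphism using (g-mono; h-mono)
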